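{- Let $G$ be a finite directed multigraph with vertex set $\{1,\dots,n+1\}$ ($n\ge1$) having a global sink at $n+1$, with reduced Laplacian $\Delta$, and let $\sigma^M$ be the minimum $G$-strongly positive script. Let $a$ be a stable configuration. The following are equivalent: (i) $a$ is super-stable; (ii) $a-\sigma\Delta$ is not non-negative for every $\sigma\in\mathbb{Z}^n$ with $\vec0\prec\sigma\preceq\sigma^M$; (iii) $a-\sigma\Delta$ is not stable for every $\sigma\in\mathbb{Z}^n$ with $\vec0\prec\sigma\preceq\sigma^M$.
   Context: Global sink: out-degree of $n+1$ is $0$ and every vertex has a directed path to $n+1$. $d^+_i$ is the out-degree of $i$, $e_{ij}$ the number of edges from $i$ to $j$. $\Delta$ is the $n\times n$ matrix with $\Delta_{ii}=d^+_i$, $\Delta_{ij}=-e_{ij}$ ($i\ne j$). A configuration is $a\in\mathbb{Z}^n$; non-negative if all $a_i\ge0$, stable if $0\le a_i\le d^+_i-1$ for all $i$. For $x,y\in\mathbb{Z}^n$: $x\succeq y$ means $x_i\ge y_i$ for all $i$; $x\succ y$ means $x\succeq y$ and $x\ne y$; $\operatorname{supp}(x)=\{i:x_i\ne0\}$. A script is an element of $\mathbb{Z}_{\ge0}^n$; it is $G$-strongly positive if $\sigma\Delta\succ\vec0$ and $\operatorname{supp}(\sigma\Delta)$ meets every strongly connected component of $G$ other than $\{n+1\}$. The minimum $G$-strongly positive script $\sigma^M$ is the $G$-strongly positive script with $\sigma\succeq\sigma^M$ for every $G$-strongly positive script $\sigma$ (the paper shows it exists). A non-negative configuration $a$ is super-stable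 if for every $\sigma\in\mathbb{Z}_{\ge0}^n$ with $\sigma\succ\vec0$, the configuration $a-\sigma\Delta$ is not non-negative. -}

module Defs where

open import Data.Nat as ℕ using (ℕ; zero; suc)
open import Data.Integer as ℤ using (ℤ; +_; _-_; _*_; _+_)
open import Data.Fin using (Fin; zero; suc; inject₁; fromℕ)
open import Data.Product using (Σ; ∃; _×_; _,_)
open import Relation.Nullary using (¬_)
open import Relation.Binary.PropositionalEquality using (_≡_; _≢_)

sumℕ : ∀ {n} → (Fin n → ℕ) → ℕ
sumℕ {zero}  f = 0
sumℕ {suc n} f = f zero ℕ.+ sumℕ (λ i → f (suc i))

sumℤ : ∀ {n} → (Fin n → ℤ) → ℤ
sumℤ {zero}  f = + 0
sumℤ {suc n} f = f zero + sumℤ (λ i → f (suc i))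

-- A finite directed multigraph on vertices Fin (suc n) (vertex k+1 of the
-- paper is Fin index k; the paper's vertex n+1 is 'sink n' = fromℕ n).
-- E u v = number of edges from u to v.
Multigraph : ℕ → Set
Multigraph n = Fin (suc n) → Fin (suc n) → ℕ

sink : (n : ℕ) → Fin (suc n)
sink n = fromℕ n

vtx : ∀ {n} → Fin n → Fin (suc n)
vtx = inject₁

outdeg : ∀ {n} → Multigraph n → Fin (suc n) → ℕ
outdeg E u = sumℕ (λ v → E u v)

data Reach {n} (E : Multigraph n) : Fin (suc n) → Fin (suc n) → Set where
  here : ∀ {u} → Reach E u u
  step : ∀ {u v w} → 0 ℕ.< E u v → Reach E v w → Reach E u w

record GlobalSink {n} (E : Multigraph n) : Set where
  field
    sink-outdeg : outdeg E (sink n) ≡ 0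
    reaches-sink : ∀ v → Reach E v (sink n)

Δ : ∀ {n} → Multigraph n → Fin n → Fin n → ℤ
Δ E i j with i Data.Fin.≟ j
... | Relation.Nullary.yes _ = + outdeg E (vtx i)
... | Relation.Nullary.no  _ = ℤ.- (+ E (vtx i) (vtx j))

Vec : ℕ → Set
Vec n = Fin n → ℤ

_·Δ[_] : ∀ {n} → Vec n → Multigraph n → Vec n
(σ ·Δ[ E ]) j = sumℤ (λ i → σ i * Δ E i j)

_⊖_ : ∀ {n} → Vec n → Vec n → Vec n
(x ⊖ y) i = x i - y i

0⃗ : ∀ {n} → Vec n
0⃗ _ = + 0

_⪰_ : ∀ {n} → Vec n → Vec n → Set
x ⪰ y = ∀ i → y i ℤ.≤ x i

_⪯_ : ∀ {n} → Vec n → Vec n → Set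
x ⪯ y = y ⪰ x

_≻_ : ∀ {n} → Vec n → Vec n → Set
x ≻ y = x ⪰ y × ¬ (x ≡ y)

_≺_ : ∀ {n} → Vec n → Vec n → Set
x ≺ y = y ≻ x

NonNeg : ∀ {n} → Vec n → Set
NonNeg a = a ⪰ 0⃗

Stable : ∀ {n} → Multigraph n → Vec n → Set
Stable E a = ∀ i → + 0 ℤ.≤ a i × a i ℤ.< + outdeg E (vtx i)

Script : ∀ {n} → Vec n → Set
Script σ = σ ⪰ 0⃗

-- supp(σΔ) meets every strongly connected component other than {n+1}.
-- Since the sink has out-degree 0, the SCCs other than {n+1} are exactly
-- the SCCs of non-sink vertices v, i.e. {w : v ↝ w and w ↝ v}.
StronglyPositive : ∀ {n} → Multigraph n → Vec n → Set
StronglyPositive {n} E σ =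
  Script σ × (σ ·Δ[ E ]) ≻ 0⃗ ×
  (∀ (v : Fin n) → ∃ λ (w : Fin n) →
     Reach E (vtx v) (vtx w) × Reach E (vtx w) (vtx v) × (σ ·Δ[ E ]) w ≢ + 0)

IsMinStronglyPositive : ∀ {n} → Multigraph n → Vec n → Set
IsMinStronglyPositive E σM =
  StronglyPositive E σM × (∀ σ → StronglyPositive E σ → σ ⪰ σM)

SuperStable : ∀ {n} → Multigraph n → Vec n → Set
SuperStable E a =
  NonNeg a × (∀ σ → Script σ → σ ≻ 0⃗ → ¬ NonNeg (a ⊖ (σ ·Δ[ E ])))

module Submission where

-- Call a script τ legal when a − τΔ is non-negative.  (i)⇒(ii) and (ii)⇒(iii)
-- are immediate; both converses rest on the truncation lemma: if σᴹΔ ⪰ 0 and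
-- a ⪰ 0, then legality of τ implies legality of max(τ − σᴹ, 0), because the
-- off-diagonal entries of Δ are non-positive.
-- (ii)⇒(i): every entry of a strongly positive script is positive (positivity
-- spreads along edges, and every vertex is reached from a vertex of its strongly
-- connected component where σᴹΔ is non-zero).  Hence truncating a legal τ ⋠ σᴹ
-- gives a non-zero legal script with smaller maximal entry; iterating, we end
-- below σᴹ, contradicting (ii).
-- (iii)⇒(ii): if a legal σ ⪯ σᴹ is not stable, fire an unstable vertex j.  This
-- keeps legality.  If σ_j < σᴹ_j the new script is still ⪯ σᴹ and closer to it;
-- if σ_j = σᴹ_j, truncating the new script leaves the unit script e_j, whose
-- legality says a_j ≥ d⁺_j, contradicting stability of a.

open import Defs
open import Data.Nat using (ℕ; _≤_)
open import Data.Product using (_×_)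
open import Relation.Nullary using (¬_)
open import Function.Bundles using (_⇔_)

open import Function.Bundles using (mk⇔)
open import Function using (_∘_)
import Data.Nat as ℕ
import Data.Nat.Properties as ℕP
open import Data.Integer
  using (ℤ; +_; -[1+_]; 0ℤ; 1ℤ; _+_; _-_; _*_; -_; _⊔_; ∣_∣; +≤+; +<+; -<+; -≤+; _≤?_; _<?_)
  renaming (_≤_ to _≤ℤ_; _<_ to _<ℤ_)
import Data.Integer.Properties as ZP
open ZP using (≤-refl; ≤-trans; ≤-reflexive; <-≤-trans; ≤-<-trans; <-irrefl; ≤-antisym)
open import Data.Integer.Tactic.RingSolver using (solve-∀)
open import Data.Fin using (Fin; zero; suc; _≟_)
open import Data.Fin.Properties using (all?; ¬∀⟶∃¬; inject₁-injective; fromℕ≢inject₁)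
open import Data.Fin.Relation.Unary.Top using (view; ‵fromℕ; ‵inject₁)
open import Data.Product using (∃; _,_; proj₁; proj₂)
open import Data.Sum using (_⊎_; inj₁; inj₂)
open import Relation.Nullary using (Dec; yes; no)
open import Relation.Binary.PropositionalEquality
open import Data.Empty using (⊥-elim)

≤-abs : ∀ i → i ≤ℤ + ∣ i ∣
≤-abs (+ m)      = ≤-refl
≤-abs -[1+ m ]   = -≤+

sub-nonneg-≤ : ∀ x {p} → 0ℤ ≤ℤ p → x - p ≤ℤ x
sub-nonneg-≤ x p≥0 = ≤-trans (ZP.+-monoʳ-≤ x (ZP.neg-mono-≤ p≥0)) (≤-reflexive (ZP.+-identityʳ x))

<⇒0<-diff : ∀ {i j} → i <ℤ j → 0ℤ <ℤ j - i
<⇒0<-diff {i} {j} i<j = subst (_<ℤ j - i) (ZP.+-inverseʳ i) (ZP.+-monoˡ-< (- i) i<j)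

sum-cong : ∀ {n} {f g : Fin n → ℤ} → (∀ i → f i ≡ g i) → sumℤ f ≡ sumℤ g
sum-cong {ℕ.zero}  h = refl
sum-cong {ℕ.suc n} h = cong₂ _+_ (h zero) (sum-cong (h ∘ suc))

sum-mono : ∀ {n} {f g : Fin n → ℤ} → (∀ i → f i ≤ℤ g i) → sumℤ f ≤ℤ sumℤ g
sum-mono {ℕ.zero}  h = ≤-refl
sum-mono {ℕ.suc n} h = ZP.+-mono-≤ (h zero) (sum-mono (h ∘ suc))

sum-zero : ∀ {n} → sumℤ {n} (λ _ → 0ℤ) ≡ 0ℤ
sum-zero {ℕ.zero}  = refl
sum-zero {ℕ.suc n} = trans (ZP.+-identityˡ _) (sum-zero {n})

sum-+ : ∀ {n} (f g : Fin n → ℤ) → sumℤ (λ i → f i + g i) ≡ sumℤ f + sumℤ g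
sum-+ {ℕ.zero}  f g = refl
sum-+ {ℕ.suc n} f g = begin
  (f zero + g zero) + sumℤ (λ i → f (suc i) + g (suc i))
    ≡⟨ cong (λ z → (f zero + g zero) + z) (sum-+ (f ∘ suc) (g ∘ suc)) ⟩
  (f zero + g zero) + (sumℤ (f ∘ suc) + sumℤ (g ∘ suc))
    ≡⟨ interchange (f zero) (g zero) (sumℤ (f ∘ suc)) (sumℤ (g ∘ suc)) ⟩
  (f zero + sumℤ (f ∘ suc)) + (g zero + sumℤ (g ∘ suc)) ∎
  where
  open ≡-Reasoning
  interchange : ∀ (a b c d : ℤ) → (a + b) + (c + d) ≡ (a + c) + (b + d)
  interchange = solve-∀

sum-neg : ∀ {n} (f : Fin n → ℤ) → sumℤ (λ i → - f i) ≡ - sumℤ f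
sum-neg {ℕ.zero}  f = refl
sum-neg {ℕ.suc n} f =
  trans (cong (λ z → - f zero + z) (sum-neg (f ∘ suc))) (sym (ZP.neg-distrib-+ (f zero) (sumℤ (f ∘ suc))))

sum-- : ∀ {n} (f g : Fin n → ℤ) → sumℤ (λ i → f i - g i) ≡ sumℤ f - sumℤ g
sum-- f g = trans (sum-+ f (λ i → - g i)) (cong (λ z → sumℤ f + z) (sum-neg g))

sum-pos : ∀ {n} (f : Fin n → ℤ) → (∀ i → 0ℤ ≤ℤ f i) → ∀ k → 0ℤ <ℤ f k → 0ℤ <ℤ sumℤ f
sum-pos {ℕ.suc n} f h zero    fk>0 =
  ZP.+-mono-<-≤ fk>0 (≤-trans (≤-reflexive (sym (sum-zero {n}))) (sum-mono (h ∘ suc)))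
sum-pos {ℕ.suc n} f h (suc k) fk>0 = ZP.+-mono-≤-< (h zero) (sum-pos (f ∘ suc) (h ∘ suc) k fk>0)

bounded : ∀ {n} (f : Fin n → ℤ) → ∃ λ N → ∀ i → f i ≤ℤ + N
bounded {ℕ.zero}  f = 0 , λ ()
bounded {ℕ.suc n} f with bounded (f ∘ suc)
... | N , f∘suc≤N = ∣ f zero ∣ ℕ.⊔ N , below
  where
  below : ∀ i → f i ≤ℤ + (∣ f zero ∣ ℕ.⊔ N)
  below zero    = ≤-trans (≤-abs (f zero)) (+≤+ (ℕP.m≤m⊔n _ N))
  below (suc i) = ≤-trans (f∘suc≤N i) (+≤+ (ℕP.m≤n⊔m _ N))

_⊕_ : ∀ {n} → Vec n → Vec n → Vec n
(x ⊕ y) i = x i + y i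

unit : ∀ {n} → Fin n → Vec n
unit zero    zero    = 1ℤ
unit zero    (suc i) = 0ℤ
unit (suc j) zero    = 0ℤ
unit (suc j) (suc i) = unit j i

unit-diag : ∀ {n} (j : Fin n) → unit j j ≡ 1ℤ
unit-diag zero    = refl
unit-diag (suc j) = unit-diag j

unit-off : ∀ {n} (j i : Fin n) → i ≢ j → unit j i ≡ 0ℤ
unit-off zero    zero    i≢j = ⊥-elim (i≢j refl)
unit-off zero    (suc i) i≢j = refl
unit-off (suc j) zero    i≢j = refl
unit-off (suc j) (suc i) i≢j = unit-off j i (i≢j ∘ cong suc)

unit-cases : ∀ {n} (P : Fin n → ℤ → Set) (j : Fin n) →
             P j 1ℤ → (∀ i → i ≢ j → P i 0ℤ) → ∀ i → P i (unit j i)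
unit-cases P j on off i with i ≟ j
... | yes refl = subst (P i) (sym (unit-diag i)) on
... | no  i≢j  = subst (P i) (sym (unit-off j i i≢j)) (off i i≢j)

unit-nonneg : ∀ {n} (j : Fin n) → Script (unit j)
unit-nonneg j = unit-cases (λ _ u → 0ℤ ≤ℤ u) j (+≤+ ℕ.z≤n) (λ _ _ → ≤-refl)

sum-unit-* : ∀ {n} (j : Fin n) (f : Fin n → ℤ) → sumℤ (λ i → unit j i * f i) ≡ f j
sum-unit-* {ℕ.suc n} zero    f =
  trans (cong₂ _+_ (ZP.*-identityˡ (f zero)) (trans (sum-cong (ZP.*-zeroˡ ∘ f ∘ suc)) (sum-zero {n})))
        (ZP.+-identityʳ (f zero))
sum-unit-* {ℕ.suc n} (suc j) f = trans (ZP.+-identityˡ _) (sum-unit-* j (f ∘ suc))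

sum-unit : ∀ {n} (j : Fin n) → sumℤ (unit j) ≡ 1ℤ
sum-unit j = trans (sum-cong (sym ∘ ZP.*-identityʳ ∘ unit j)) (sum-unit-* j (λ _ → 1ℤ))

⪯-or-exceeds : ∀ {n} (x y : Vec n) → x ⪯ y ⊎ ∃ λ j → y j <ℤ x j
⪯-or-exceeds {n} x y with all? (λ i → x i ≤? y i)
... | yes x⪯y = inj₁ x⪯y
... | no  x⋠y with ¬∀⟶∃¬ n _ (λ i → x i ≤? y i) x⋠y
...   | j , xj≰yj = inj₂ (j , ZP.≰⇒> xj≰yj)

stable-or-unstable : ∀ {n} (E : Multigraph n) (b : Vec n) → NonNeg b →
                     Stable E b ⊎ ∃ λ j → + outdeg E (vtx j) ≤ℤ b j
stable-or-unstable {n} E b b⪰0 with all? (λ i → b i <? + outdeg E (vtx i))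
... | yes below = inj₁ (λ i → b⪰0 i , below i)
... | no  ¬below with ¬∀⟶∃¬ n _ (λ i → b i <? + outdeg E (vtx i)) ¬below
...   | j , bj≮dj = inj₂ (j , ZP.≮⇒≥ bj≮dj)

module Laplacian {n} (E : Multigraph n) where

  Δ-diag : ∀ i → Δ E i i ≡ + outdeg E (vtx i)
  Δ-diag i with i ≟ i
  ... | yes _   = refl
  ... | no  i≢i = ⊥-elim (i≢i refl)

  Δ-off : ∀ i j → i ≢ j → Δ E i j ≡ - + E (vtx i) (vtx j)
  Δ-off i j i≢j with i ≟ j
  ... | yes i≡j = ⊥-elim (i≢j i≡j)
  ... | no  _   = refl

  -- Off-diagonal entries are non-positive, so multiplying by them reverses ≤.
  Δ-off-antitone : ∀ i j → i ≢ j → ∀ {x y} → x ≤ℤ y → y * Δ E i j ≤ℤ x * Δ E i j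
  Δ-off-antitone i j i≢j {x} {y} x≤y rewrite Δ-off i j i≢j = by-edges (E (vtx i) (vtx j))
    where
    by-edges : ∀ e → y * - + e ≤ℤ x * - + e
    by-edges ℕ.zero    = ≤-reflexive (trans (ZP.*-zeroʳ y) (sym (ZP.*-zeroʳ x)))
    by-edges (ℕ.suc e) = ZP.*-monoʳ-≤-nonPos -[1+ e ] x≤y

  ·Δ-cong : ∀ {x y : Vec n} → (∀ i → x i ≡ y i) → ∀ j → (x ·Δ[ E ]) j ≡ (y ·Δ[ E ]) j
  ·Δ-cong x≡y j = sum-cong (λ i → cong (_* Δ E i j) (x≡y i))

  ·Δ-zero : ∀ j → (0⃗ ·Δ[ E ]) j ≡ 0ℤ
  ·Δ-zero j = trans (sum-cong (λ i → ZP.*-zeroˡ (Δ E i j))) (sum-zero {n})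

  ·Δ-unit : ∀ k j → (unit k ·Δ[ E ]) j ≡ Δ E k j
  ·Δ-unit k j = sum-unit-* k (λ i → Δ E i j)

  ·Δ-⊕ : ∀ (x y : Vec n) j → ((x ⊕ y) ·Δ[ E ]) j ≡ (x ·Δ[ E ]) j + (y ·Δ[ E ]) j
  ·Δ-⊕ x y j = trans (sum-cong (λ i → ZP.*-distribʳ-+ (Δ E i j) (x i) (y i)))
                     (sum-+ (λ i → x i * Δ E i j) (λ i → y i * Δ E i j))

  ·Δ-⊖ : ∀ (x y : Vec n) j → ((x ⊖ y) ·Δ[ E ]) j ≡ (x ·Δ[ E ]) j - (y ·Δ[ E ]) j
  ·Δ-⊖ x y j = trans (sum-cong (λ i → distrib (x i) (y i) (Δ E i j)))
                     (sum-- (λ i → x i * Δ E i j) (λ i → y i * Δ E i j))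
    where
    distrib : ∀ (a b d : ℤ) → (a - b) * d ≡ a * d - b * d
    distrib = solve-∀

  ·Δ-antitone : ∀ {τ τ' : Vec n} j → τ ⪯ τ' → τ j ≡ τ' j → (τ' ·Δ[ E ]) j ≤ℤ (τ ·Δ[ E ]) j
  ·Δ-antitone {τ} {τ'} j τ⪯τ' τj≡τ'j = sum-mono term
    where
    by-cases : ∀ i → Dec (i ≡ j) → τ' i * Δ E i j ≤ℤ τ i * Δ E i j
    by-cases i (yes refl) = ≤-reflexive (cong (_* Δ E i i) (sym τj≡τ'j))
    by-cases i (no  i≢j)  = Δ-off-antitone i j i≢j (τ⪯τ' i)
    term : ∀ i → τ' i * Δ E i j ≤ℤ τ i * Δ E i j
    term i = by-cases i (i ≟ j)

trunc : ∀ {n} → Vec n → Vec n → Vec n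
trunc τ σ i = (τ i - σ i) ⊔ 0ℤ

trunc-script : ∀ {n} (τ σ : Vec n) → Script (trunc τ σ)
trunc-script τ σ i = ZP.i≤j⊔i (τ i - σ i) 0ℤ

trunc-legal : ∀ {n} (E : Multigraph n) (σ a τ : Vec n) → (σ ·Δ[ E ]) ⪰ 0⃗ → NonNeg a →
              NonNeg (a ⊖ (τ ·Δ[ E ])) → NonNeg (a ⊖ (trunc τ σ ·Δ[ E ]))
trunc-legal E σ a τ σΔ⪰0 a⪰0 τ-legal j = ZP.i≤j⇒0≤j-i (bound (ZP.⊔-sel (τ j - σ j) 0ℤ))
  where
  open Laplacian E
  open ZP.≤-Reasoning
  μ = trunc τ σ
  bound : μ j ≡ τ j - σ j ⊎ μ j ≡ 0ℤ → (μ ·Δ[ E ]) j ≤ℤ a j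
  bound (inj₁ μj≡τj-σj) = begin
    (μ ·Δ[ E ]) j                       ≤⟨ ·Δ-antitone {τ = τ ⊖ σ} j (λ i → ZP.i≤i⊔j _ _) (sym μj≡τj-σj) ⟩
    ((τ ⊖ σ) ·Δ[ E ]) j                 ≡⟨ ·Δ-⊖ τ σ j ⟩
    (τ ·Δ[ E ]) j - (σ ·Δ[ E ]) j       ≤⟨ sub-nonneg-≤ _ (σΔ⪰0 j) ⟩
    (τ ·Δ[ E ]) j                       ≤⟨ ZP.0≤i-j⇒j≤i (τ-legal j) ⟩
    a j                                 ∎
  bound (inj₂ μj≡0) = begin
    (μ ·Δ[ E ]) j                       ≤⟨ ·Δ-antitone j (trunc-script τ σ) (sym μj≡0) ⟩
    (0⃗ ·Δ[ E ]) j                       ≡⟨ ·Δ-zero j ⟩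
    0ℤ                                  ≤⟨ a⪰0 j ⟩
    a j                                 ∎

module Positivity {n} (E : Multigraph n) (gs : GlobalSink E) where
  open Laplacian E
  open GlobalSink gs

  path-from-sink : ∀ {s t} → Reach E s t → s ≡ sink n → t ≡ sink n
  path-from-sink here             s≡sink = s≡sink
  path-from-sink (step {v = y} e r) refl = ⊥-elim (ℕP.<-irrefl (sym no-edge) e)
    where
    no-edge : E (sink n) y ≡ 0
    no-edge = no-out-edges (E (sink n)) sink-outdeg y
      where
      no-out-edges : ∀ {m} (f : Fin m → ℕ) → sumℕ f ≡ 0 → ∀ x → f x ≡ 0
      no-out-edges f sum≡0 zero    = ℕP.m+n≡0⇒m≡0 (f zero) sum≡0
      no-out-edges f sum≡0 (suc x) = no-out-edges (f ∘ suc) (ℕP.m+n≡0⇒n≡0 (f zero) sum≡0) x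

  unit-below : ∀ {τ : Vec n} i → Script τ → 1ℤ ≤ℤ τ i → unit i ⪯ τ
  unit-below {τ} i τ⪰0 τi≥1 = unit-cases (λ k u → u ≤ℤ τ k) i τi≥1 (λ k _ → τ⪰0 k)

  -- For τ ⪰ 0 with τΔ ⪰ 0, positivity spreads along an edge i → j:
  -- if τ_j = 0 then (τΔ)_j ≤ (e_iΔ)_j = −e_ij < 0.
  positive-spreads : ∀ {τ : Vec n} → Script τ → (τ ·Δ[ E ]) ⪰ 0⃗ → ∀ i j →
                     0ℤ <ℤ τ i → 0 ℕ.< E (vtx i) (vtx j) → 0ℤ <ℤ τ j
  positive-spreads {τ} τ⪰0 τΔ⪰0 i j τi>0 edge with 0ℤ <? τ j
  ... | yes τj>0 = τj>0
  ... | no  τj≯0 = ⊥-elim (<-irrefl refl (≤-<-trans (τΔ⪰0 j) τΔj<0))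
    where
    τj≡0 : τ j ≡ 0ℤ
    τj≡0 = ≤-antisym (ZP.≮⇒≥ τj≯0) (τ⪰0 j)
    i≢j : i ≢ j
    i≢j refl = <-irrefl (sym τj≡0) τi>0
    negative-entry : ∀ e → 0 ℕ.< e → - + e <ℤ 0ℤ
    negative-entry (ℕ.suc e) _ = -<+
    τΔj<0 : (τ ·Δ[ E ]) j <ℤ 0ℤ
    τΔj<0 = ≤-<-trans
      (≤-trans (·Δ-antitone j (unit-below i τ⪰0 (ZP.i<j⇒suc[i]≤j τi>0))
                             (trans (unit-off i j (i≢j ∘ sym)) (sym τj≡0)))
               (≤-reflexive (trans (·Δ-unit i j) (Δ-off i j i≢j))))
      (negative-entry _ edge)

  -- Positivity spreads along paths; a path from a non-sink vertex never enters
  -- the sink, because it could not leave it again.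
  positive-along-path : ∀ {τ : Vec n} → Script τ → (τ ·Δ[ E ]) ⪰ 0⃗ →
                        ∀ {u t} → Reach E u t → ∀ i → u ≡ vtx i → 0ℤ <ℤ τ i →
                        ∀ v → t ≡ vtx v → 0ℤ <ℤ τ v
  positive-along-path τ⪰0 τΔ⪰0 here i u≡i τi>0 v t≡v
    rewrite inject₁-injective (trans (sym u≡i) t≡v) = τi>0
  positive-along-path τ⪰0 τΔ⪰0 (step {v = x} e r) i refl τi>0 v t≡v with view x
  ... | ‵fromℕ     = ⊥-elim (fromℕ≢inject₁ (trans (sym (path-from-sink r refl)) t≡v))
  ... | ‵inject₁ k = positive-along-path τ⪰0 τΔ⪰0 r k refl
                       (positive-spreads τ⪰0 τΔ⪰0 i k τi>0 e) v t≡v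

  strongly-positive⇒positive : ∀ {σ : Vec n} → StronglyPositive E σ → ∀ v → 0ℤ <ℤ σ v
  strongly-positive⇒positive {σ} (σ⪰0 , (σΔ⪰0 , _) , hits-component) v
    with hits-component v
  ... | w , _ , w↝v , σΔw≢0 = positive-along-path σ⪰0 σΔ⪰0 w↝v w refl σw>0 v refl
    where
    -- σ_w = 0 would force (σΔ)_w ≤ (0Δ)_w = 0, hence (σΔ)_w = 0.
    σw>0 : 0ℤ <ℤ σ w
    σw>0 with 0ℤ <? σ w
    ... | yes σw>0 = σw>0
    ... | no  σw≯0 = ⊥-elim (σΔw≢0 (≤-antisym σΔw≤0 (σΔ⪰0 w)))
      where
      σΔw≤0 : (σ ·Δ[ E ]) w ≤ℤ 0ℤ
      σΔw≤0 = ≤-trans (·Δ-antitone w σ⪰0 (≤-antisym (σ⪰0 w) (ZP.≮⇒≥ σw≯0)))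
                      (≤-reflexive (·Δ-zero w))

fire-legal : ∀ {n} (E : Multigraph n) (a τ : Vec n) j → NonNeg (a ⊖ (τ ·Δ[ E ])) →
             + outdeg E (vtx j) ≤ℤ (a ⊖ (τ ·Δ[ E ])) j → NonNeg (a ⊖ ((τ ⊕ unit j) ·Δ[ E ]))
fire-legal E a τ j τ-legal unstable i =
  subst (0ℤ ≤ℤ_) (sym after-firing) (ZP.i≤j⇒0≤j-i (row-entry-below (i ≟ j)))
  where
  open Laplacian E
  after-firing : a i - ((τ ⊕ unit j) ·Δ[ E ]) i ≡ (a i - (τ ·Δ[ E ]) i) - Δ E j i
  after-firing = trans (cong (λ z → a i - z) (trans (·Δ-⊕ τ (unit j) i) (cong (λ z → (τ ·Δ[ E ]) i + z) (·Δ-unit j i))))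
                       (reassoc (a i) ((τ ·Δ[ E ]) i) (Δ E j i))
    where
    reassoc : ∀ (x r d : ℤ) → x - (r + d) ≡ (x - r) - d
    reassoc = solve-∀
  row-entry-below : Dec (i ≡ j) → Δ E j i ≤ℤ a i - (τ ·Δ[ E ]) i
  row-entry-below (yes refl) = ≤-trans (≤-reflexive (Δ-diag i)) unstable
  row-entry-below (no  i≢j) rewrite Δ-off j i (i≢j ∘ sym) =
    ≤-trans (ZP.neg-mono-≤ (+≤+ ℕ.z≤n)) (τ-legal i)

fire-⪯ : ∀ {n} (x y : Vec n) j → x ⪯ y → x j <ℤ y j → (x ⊕ unit j) ⪯ y
fire-⪯ x y j x⪯y xj<yj = unit-cases (λ i u → x i + u ≤ℤ y i) j
  (subst (_≤ℤ y j) (ZP.+-comm 1ℤ (x j)) (ZP.i<j⇒suc[i]≤j xj<yj))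
  (λ i _ → subst (_≤ℤ y i) (sym (ZP.+-identityʳ (x i))) (x⪯y i))

fire-gap : ∀ {n} (x y : Vec n) j → sumℤ (y ⊖ (x ⊕ unit j)) ≡ sumℤ (y ⊖ x) - 1ℤ
fire-gap x y j = trans (sum-cong (λ i → reassoc (y i) (x i) (unit j i)))
                       (trans (sum-- (y ⊖ x) (unit j)) (cong (λ z → sumℤ (y ⊖ x) - z) (sum-unit j)))
  where
  reassoc : ∀ (s r d : ℤ) → s - (r + d) ≡ (s - r) - d
  reassoc = solve-∀

fire-overshoot : ∀ {n} (x y : Vec n) j → x ⪯ y → x j ≡ y j → ∀ i → trunc (x ⊕ unit j) y i ≡ unit j i
fire-overshoot x y j x⪯y xj≡yj = unit-cases (λ i u → ((x i + u) - y i) ⊔ 0ℤ ≡ u) j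
  (trans (cong (λ z → ((x j + 1ℤ) - z) ⊔ 0ℤ) (sym xj≡yj)) (cong (_⊔ 0ℤ) (cancel (x j))))
  (λ i _ → ZP.i≤j⇒i⊔j≡j (subst (λ z → z - y i ≤ℤ 0ℤ) (sym (ZP.+-identityʳ (x i)))
                                 (ZP.i≤j⇒i-j≤0 (x⪯y i))))
  where
  cancel : ∀ (r : ℤ) → (r + 1ℤ) - r ≡ 1ℤ
  cancel = solve-∀

module Implications {n} (E : Multigraph n) (gs : GlobalSink E) (σᴹ : Vec n)
                    (σᴹ-sp : StronglyPositive E σᴹ) (a : Vec n) (a-stable : Stable E a) where
  open Laplacian E

  Legal : Vec n → Set
  Legal τ = NonNeg (a ⊖ (τ ·Δ[ E ]))

  NoLegalBelow NoStableBelow : Set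
  NoLegalBelow  = ∀ σ → 0⃗ ≺ σ → σ ⪯ σᴹ → ¬ Legal σ
  NoStableBelow = ∀ σ → 0⃗ ≺ σ → σ ⪯ σᴹ → ¬ Stable E (a ⊖ (σ ·Δ[ E ]))

  a⪰0 : NonNeg a
  a⪰0 i = proj₁ (a-stable i)

  σᴹΔ⪰0 : (σᴹ ·Δ[ E ]) ⪰ 0⃗
  σᴹΔ⪰0 = proj₁ (proj₁ (proj₂ σᴹ-sp))

  σᴹ>0 : ∀ v → 0ℤ <ℤ σᴹ v
  σᴹ>0 = Positivity.strongly-positive⇒positive E gs σᴹ-sp

  nonzero : ∀ (ρ : Vec n) k → 0ℤ <ℤ ρ k → ρ ≢ 0⃗
  nonzero ρ k ρk>0 ρ≡0 = <-irrefl (sym (cong (λ f → f k) ρ≡0)) ρk>0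

  i⇒ii : SuperStable E a → NoLegalBelow
  i⇒ii (_ , no-legal) σ 0≺σ _ = no-legal σ (proj₁ 0≺σ) 0≺σ

  ii⇒iii : NoLegalBelow → NoStableBelow
  ii⇒iii no-legal σ 0≺σ σ⪯σᴹ stable = no-legal σ 0≺σ σ⪯σᴹ (proj₁ ∘ stable)

  -- Descent for (ii)⇒(i), on a bound N for the entries of the legal script ρ:
  -- if ρ ⋠ σᴹ then trunc ρ σᴹ is legal, non-zero, and its entries are ≤ N − 1.
  module _ (no-legal : NoLegalBelow) where
    descend : ∀ N (ρ : Vec n) → Script ρ → ρ ≢ 0⃗ → (∀ i → ρ i ≤ℤ + N) → ¬ Legal ρ
    descend N ρ ρ⪰0 ρ≢0 ρ≤N ρ-legal with ⪯-or-exceeds ρ σᴹ | N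
    ... | inj₁ ρ⪯σᴹ       | _ = no-legal ρ (ρ⪰0 , ρ≢0) ρ⪯σᴹ ρ-legal
    ... | inj₂ (j , σᴹj<ρj) | ℕ.zero =
      <-irrefl refl (<-≤-trans (ZP.<-trans (σᴹ>0 j) σᴹj<ρj) (ρ≤N j))
    ... | inj₂ (j , σᴹj<ρj) | ℕ.suc N' =
      descend N' μ (trunc-script ρ σᴹ) (nonzero μ j μj>0) μ≤N'
              (trunc-legal E σᴹ a ρ σᴹΔ⪰0 a⪰0 ρ-legal)
      where
      μ = trunc ρ σᴹ
      μj>0 : 0ℤ <ℤ μ j
      μj>0 = <-≤-trans (<⇒0<-diff σᴹj<ρj) (ZP.i≤i⊔j _ _)
      μ≤N' : ∀ i → μ i ≤ℤ + N'
      μ≤N' i = ZP.⊔-lub (ZP.+-mono-≤ (ρ≤N i) (ZP.neg-mono-≤ (ZP.i<j⇒suc[i]≤j (σᴹ>0 i))))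
                        (+≤+ ℕ.z≤n)

    ii⇒i : SuperStable E a
    ii⇒i = a⪰0 , λ σ _ (σ⪰0 , σ≢0) σ-legal →
      descend (proj₁ (bounded σ)) σ σ⪰0 σ≢0 (proj₂ (bounded σ)) σ-legal

  -- Descent for (iii)⇒(ii), on a bound K for the gap Σ (σᴹ − ρ): a legal
  -- ρ ⪯ σᴹ is not stable, so fire an unstable vertex j; at the bound this
  -- would make e_j legal, i.e. a_j ≥ d⁺_j.
  module _ (no-stable : NoStableBelow) where
    fire-up : ∀ K (ρ : Vec n) → Script ρ → ρ ≢ 0⃗ → ρ ⪯ σᴹ → sumℤ (σᴹ ⊖ ρ) ≤ℤ + K → ¬ Legal ρ
    fire-up K ρ ρ⪰0 ρ≢0 ρ⪯σᴹ gap≤K ρ-legal with stable-or-unstable E _ ρ-legal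
    ... | inj₁ stable = no-stable ρ (ρ⪰0 , ρ≢0) ρ⪯σᴹ stable
    ... | inj₂ (j , unstable) with ρ j <? σᴹ j
    ...   | no ρj≮σᴹj = <-irrefl refl (<-≤-trans (proj₂ (a-stable j)) dj≤aj)
      where
      eⱼ-legal : Legal (unit j)
      eⱼ-legal i = subst (λ z → 0ℤ ≤ℤ a i - z)
        (·Δ-cong (fire-overshoot ρ σᴹ j ρ⪯σᴹ (≤-antisym (ρ⪯σᴹ j) (ZP.≮⇒≥ ρj≮σᴹj))) i)
        (trunc-legal E σᴹ a (ρ ⊕ unit j) σᴹΔ⪰0 a⪰0 (fire-legal E a ρ j ρ-legal unstable) i)
      dj≤aj : + outdeg E (vtx j) ≤ℤ a j
      dj≤aj = ZP.0≤i-j⇒j≤i (subst (λ z → 0ℤ ≤ℤ a j - z)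
                                   (trans (·Δ-unit j j) (Δ-diag j)) (eⱼ-legal j))
    ...   | yes ρj<σᴹj with K
    ...     | ℕ.zero = <-irrefl refl (<-≤-trans gap>0 gap≤K)
      where
      gap>0 : 0ℤ <ℤ sumℤ (σᴹ ⊖ ρ)
      gap>0 = sum-pos _ (λ i → ZP.i≤j⇒0≤j-i (ρ⪯σᴹ i)) j (<⇒0<-diff ρj<σᴹj)
    ...     | ℕ.suc K' =
      fire-up K' (ρ ⊕ unit j) (λ i → ZP.+-mono-≤ (ρ⪰0 i) (unit-nonneg j i))
              (nonzero _ j fired>0) (fire-⪯ ρ σᴹ j ρ⪯σᴹ ρj<σᴹj)
              (subst (_≤ℤ + K') (sym (fire-gap ρ σᴹ j)) (ZP.+-monoˡ-≤ (- 1ℤ) gap≤K))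
              (fire-legal E a ρ j ρ-legal unstable)
      where
      fired>0 : 0ℤ <ℤ ρ j + unit j j
      fired>0 = subst (λ u → 0ℤ <ℤ ρ j + u) (sym (unit-diag j))
                      (ZP.+-mono-≤-< (ρ⪰0 j) (+<+ (ℕ.s≤s ℕ.z≤n)))

    iii⇒ii : NoLegalBelow
    iii⇒ii σ (σ⪰0 , σ≢0) σ⪯σᴹ = fire-up ∣ sumℤ (σᴹ ⊖ σ) ∣ σ σ⪰0 σ≢0 σ⪯σᴹ (≤-abs _)

corollary4p3 : (n : ℕ) → 1 ≤ n → (E : Multigraph n) → GlobalSink E →
    (σM : Vec n) → IsMinStronglyPositive E σM →
    (a : Vec n) → Stable E a →
    (SuperStable E a ⇔ (∀ σ → 0⃗ ≺ σ → σ ⪯ σM → ¬ NonNeg (a ⊖ (σ ·Δ[ E ]))))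
    × ((∀ σ → 0⃗ ≺ σ → σ ⪯ σM → ¬ NonNeg (a ⊖ (σ ·Δ[ E ])))
    ⇔ (∀ σ → 0⃗ ≺ σ → σ ⪯ σM → ¬ Stable E (a ⊖ (σ ·Δ[ E ]))))
corollary4p3 n _ E gs σM (σM-sp , _) a a-stable =
  mk⇔ i⇒ii ii⇒i , mk⇔ ii⇒iii iii⇒ii
  where open Implications E gs σM σM-sp a a-stable
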